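{- Let $G$ be a group and $\pi$ a collection of $\ell$ distinct subsets of $G$, each of size $k$ and containing $e$, pairwise intersecting exactly in $\{e\}$ and satisfying the $T$-axiom. Then for every $C\in\pi$, $\mathrm{Stab}_G(C)=C\cap C^{ -1}$.
   Context: For $C\subseteq G$ and $g\in G$, $gC=\{gs:s\in C\}$ and $C^{ -1}=\{s^{ -1}:s\in C\}$. A collection $\pi$ of subsets of $G$, each containing $e$, satisfies the $T$-axiom if for every $C\in\pi$ and $s\in C$, $s^{ -1}C\in\pi$. $\mathrm{Stab}_G(C)=\{x\in G: xC=C\}$ is the setwise stabilizer under left multiplication. -}

module Defs where

open import Level using (_⊔_)
open import Algebra.Bundles using (Group)
open import Data.Nat using (ℕ)
open import Data.Fin using (Fin)
open import Data.Product using (Σ; ∃; _×_)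
open import Relation.Binary.PropositionalEquality using (_≡_)

module _ {c r : Level.Level} (G : Group c r) where
  open Group G

  -- A finite subset of G given by an enumeration of its elements.
  FinSubset : ℕ → Set c
  FinSubset k = Fin k → Carrier

  _∈ₛ_ : {k : ℕ} → Carrier → FinSubset k → Set r
  x ∈ₛ C = ∃ λ i → x ≈ C i

  -- The enumeration has no repetitions, so the subset has exactly k elements.
  HasSize : {k : ℕ} → FinSubset k → Set r
  HasSize {k} C = (i j : Fin k) → C i ≈ C j → i ≡ j

  SameSet : {k m : ℕ} → FinSubset k → FinSubset m → Set (c ⊔ r)
  SameSet C D = ∀ x → (x ∈ₛ C → x ∈ₛ D) × (x ∈ₛ D → x ∈ₛ C)

  translate : {k : ℕ} → Carrier → FinSubset k → FinSubset k
  translate g C i = g ∙ C i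

  inverseSet : {k : ℕ} → FinSubset k → FinSubset k
  inverseSet C i = C i ⁻¹

  InStab : {k : ℕ} → FinSubset k → Carrier → Set (c ⊔ r)
  InStab C x = SameSet (translate x C) C

  T-axiom : {k ℓ : ℕ} → (Fin ℓ → FinSubset k) → Set (c ⊔ r)
  T-axiom {ℓ = ℓ} π =
    (i : Fin ℓ) (s : Carrier) → s ∈ₛ π i →
    Σ (Fin ℓ) λ j → SameSet (π j) (translate (s ⁻¹) (π i))

module Submission where

open import Defs
open import Level using (Level)
open import Algebra.Bundles using (Group)
import Algebra.Properties.Group as GroupProperties
open import Data.Nat using (ℕ)
open import Data.Fin using (Fin; _≟_)
open import Data.Product using (_×_; _,_; proj₁; proj₂)
open import Relation.Nullary using (¬_; yes; no)
open import Relation.Binary.PropositionalEquality using (_≡_; refl)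

-- If xC = C then x = x·e ∈ C, and e ∈ xC gives e = x·s with s ∈ C, so x⁻¹ = s ∈ C.
-- Conversely, if x, x⁻¹ ∈ C then the T-axiom puts xC = (x⁻¹)⁻¹C into π; it contains
-- x = x·e ∈ C, so either xC is C itself or x lies in two distinct blocks and hence x = e.

module _ {c r : Level} (G : Group c r) where
  open Group G
  open GroupProperties G

  private
    infix 4 _∈_
    _∈_ : {k : ℕ} → Carrier → FinSubset G k → Set r
    _∈_ = _∈ₛ_ G

  ∈-resp-≈ : {k : ℕ} {C : FinSubset G k} {x y : Carrier} → x ≈ y → x ∈ C → y ∈ C
  ∈-resp-≈ x≈y (i , x≈Cᵢ) = i , trans (sym x≈y) x≈Cᵢ

  ∈-translate : {k : ℕ} {C : FinSubset G k} (g : Carrier) {x : Carrier} →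
                x ∈ C → (g ∙ x) ∈ translate G g C
  ∈-translate g (i , x≈Cᵢ) = i , ∙-congˡ x≈Cᵢ

  ∈-translate-ε : {k : ℕ} {C : FinSubset G k} (g : Carrier) → ε ∈ C → g ∈ translate G g C
  ∈-translate-ε g ε∈C = ∈-resp-≈ (identityʳ g) (∈-translate g ε∈C)

  ∈-inverseSet : {k : ℕ} {C : FinSubset G k} {x : Carrier} → x ⁻¹ ∈ C → x ∈ inverseSet G C
  ∈-inverseSet {x = x} (i , x⁻¹≈Cᵢ) = i , trans (sym (⁻¹-involutive x)) (⁻¹-cong x⁻¹≈Cᵢ)

  inverseSet-∈ : {k : ℕ} {C : FinSubset G k} {x : Carrier} → x ∈ inverseSet G C → x ⁻¹ ∈ C
  inverseSet-∈ {C = C} (i , x≈Cᵢ⁻¹) = i , trans (⁻¹-cong x≈Cᵢ⁻¹) (⁻¹-involutive (C i))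

  SameSet-sym : {k m : ℕ} {C : FinSubset G k} {D : FinSubset G m} →
                SameSet G C D → SameSet G D C
  SameSet-sym C≡D x = proj₂ (C≡D x) , proj₁ (C≡D x)

  SameSet-trans : {k m n : ℕ} {C : FinSubset G k} {D : FinSubset G m} {E : FinSubset G n} →
                  SameSet G C D → SameSet G D E → SameSet G C E
  SameSet-trans C≡D D≡E x =
    (λ x∈C → proj₁ (D≡E x) (proj₁ (C≡D x) x∈C)) ,
    (λ x∈E → proj₂ (C≡D x) (proj₂ (D≡E x) x∈E))

  translate-cong : {k : ℕ} {C : FinSubset G k} {g h : Carrier} →
                   g ≈ h → SameSet G (translate G g C) (translate G h C)
  translate-cong g≈h x =
    (λ { (i , x≈gCᵢ) → i , trans x≈gCᵢ (∙-congʳ g≈h) }) ,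
    (λ { (i , x≈hCᵢ) → i , trans x≈hCᵢ (∙-congʳ (sym g≈h)) })

  translate-identity : {k : ℕ} {C : FinSubset G k} → SameSet G (translate G ε C) C
  translate-identity x =
    (λ { (i , x≈εCᵢ) → i , trans x≈εCᵢ (identityˡ _) }) ,
    (λ { (i , x≈Cᵢ) → i , trans x≈Cᵢ (sym (identityˡ _)) })

  InStab-identity : {k : ℕ} {C : FinSubset G k} {x : Carrier} → x ≈ ε → InStab G C x
  InStab-identity x≈ε = SameSet-trans (translate-cong x≈ε) translate-identity

  InStab⇒∈×∈-inverseSet : {k : ℕ} {C : FinSubset G k} {x : Carrier} →
                          ε ∈ C → InStab G C x → x ∈ C × x ∈ inverseSet G C
  InStab⇒∈×∈-inverseSet {C = C} {x} ε∈C xC≡C = x∈C , ∈-inverseSet x⁻¹∈C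
    where
    x∈C : x ∈ C
    x∈C = proj₁ (xC≡C x) (∈-translate-ε x ε∈C)

    x⁻¹∈C : x ⁻¹ ∈ C
    x⁻¹∈C with proj₂ (xC≡C ε) ε∈C
    ... | i , ε≈xCᵢ = i , sym (inverseʳ-unique x (C i) (sym ε≈xCᵢ))

  module _ {k ℓ : ℕ} (π : Fin ℓ → FinSubset G k)
           (ε∈π : (i : Fin ℓ) → ε ∈ π i)
           (π-trivial-∩ : (i j : Fin ℓ) → ¬ (i ≡ j) → (x : Carrier) →
                          x ∈ π i → x ∈ π j → x ≈ ε)
           (T : T-axiom G π) where

    ∈×∈-inverseSet⇒InStab : (i : Fin ℓ) {x : Carrier} →
                            x ∈ π i → x ∈ inverseSet G (π i) → InStab G (π i) x
    ∈×∈-inverseSet⇒InStab i {x} x∈πᵢ x∈πᵢ⁻¹ with T i (x ⁻¹) (inverseSet-∈ x∈πᵢ⁻¹)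
    ... | j , πⱼ≡x⁻¹⁻¹πᵢ =
      stable (SameSet-sym (SameSet-trans πⱼ≡x⁻¹⁻¹πᵢ (translate-cong (⁻¹-involutive x))))
      where
      stable : SameSet G (translate G x (π i)) (π j) → InStab G (π i) x
      stable xπᵢ≡πⱼ with j ≟ i
      ... | yes refl = xπᵢ≡πⱼ
      ... | no j≢i   = InStab-identity (π-trivial-∩ j i j≢i x x∈πⱼ x∈πᵢ)
        where
        x∈πⱼ : x ∈ π j
        x∈πⱼ = proj₁ (xπᵢ≡πⱼ x) (∈-translate-ε x (ε∈π i))

proposition6p6 : {c r : Level} (G : Group c r) (k ℓ : ℕ)
    (π : Fin ℓ → FinSubset G k) →
    ((i : Fin ℓ) → HasSize G (π i)) →
    ((i j : Fin ℓ) → ¬ (i ≡ j) → ¬ SameSet G (π i) (π j)) →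
    ((i : Fin ℓ) → _∈ₛ_ G (Group.ε G) (π i)) →
    ((i j : Fin ℓ) → ¬ (i ≡ j) → (x : Group.Carrier G) →
      _∈ₛ_ G x (π i) → _∈ₛ_ G x (π j) → Group._≈_ G x (Group.ε G)) →
    T-axiom G π →
    (i : Fin ℓ) (x : Group.Carrier G) →
      (InStab G (π i) x → (_∈ₛ_ G x (π i) × _∈ₛ_ G x (inverseSet G (π i))))
      × ((_∈ₛ_ G x (π i) × _∈ₛ_ G x (inverseSet G (π i))) → InStab G (π i) x)
proposition6p6 G k ℓ π _ _ ε∈π π-trivial-∩ T i x =
  InStab⇒∈×∈-inverseSet G (ε∈π i) ,
  λ (x∈πᵢ , x∈πᵢ⁻¹) → ∈×∈-inverseSet⇒InStab G π ε∈π π-trivial-∩ T i x∈πᵢ x∈πᵢ⁻¹
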